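{- Let $n\ge1$ and let $\mathbf{t},\mathbf{u}\in\mathbf{M}^n$ with $\mathbf{t}\not\le\mathbf{u}$ and $\mathbf{u}\not\le\mathbf{t}$. Then \[ \rho(\mathbf{t})(2n-\rho(\mathbf{t}))+\rho(\mathbf{u})(2n-\rho(\mathbf{u})) > \rho(\mathbf{t}\wedge\mathbf{u})(2n-\rho(\mathbf{t}\wedge\mathbf{u}))+\rho(\mathbf{t}\vee\mathbf{u})(2n-\rho(\mathbf{t}\vee\mathbf{u})). \]
   Context: Let $\mathbf{M}$ be a diamond: elements a bottom $0_M$, a top $1_M$, and a finite set $A$ of atoms with $|A|\ge3$, $0_M<a<1_M$ for all $a\in A$, distinct atoms incomparable. $\mathbf{M}^n$ is the product lattice (coordinatewise order, meet, join). The rank function is $\rho(0_M)=0$, $\rho(a)=1$ for $a\in A$, $\rho(1_M)=2$, extended to $\mathbf{M}^n$ by $\rho(\mathbf{t})=\sum_{i=1}^n\rho(\mathbf{t}(i))$. -}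

module Defs where

open import Data.Nat using (ℕ; zero; suc; _+_; _*_; _∸_; _≤_)
open import Data.Fin using (Fin)
open import Data.Fin.Properties using (_≟_)
open import Relation.Nullary using (yes; no; ¬_)
open import Data.Empty using (⊥)
open import Data.Unit using (⊤)

-- The diamond M with atom set A = Fin k (|A| = k; the hypothesis k ≥ 3 is in the statement).
data M (k : ℕ) : Set where
  bot  : M k
  atom : Fin k → M k
  top  : M k

data _≤M_ {k : ℕ} : M k → M k → Set where
  bot≤  : ∀ {x} → bot ≤M x
  ≤top  : ∀ {x} → x ≤M top
  atom≤ : ∀ {a} → atom a ≤M atom a

_∧M_ : ∀ {k} → M k → M k → M k
bot    ∧M y      = bot
top    ∧M y      = y
atom a ∧M bot    = bot
atom a ∧M top    = atom a
atom a ∧M atom b with a ≟ b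
... | yes _ = atom a
... | no  _ = bot

_∨M_ : ∀ {k} → M k → M k → M k
bot    ∨M y      = y
top    ∨M y      = top
atom a ∨M bot    = atom a
atom a ∨M top    = top
atom a ∨M atom b with a ≟ b
... | yes _ = atom a
... | no  _ = top

ρM : ∀ {k} → M k → ℕ
ρM bot      = 0
ρM (atom _) = 1
ρM top      = 2

Mⁿ : ℕ → ℕ → Set
Mⁿ k n = Fin n → M k

_≤ⁿ_ : ∀ {k n} → Mⁿ k n → Mⁿ k n → Set
t ≤ⁿ u = ∀ i → t i ≤M u i

_∧ⁿ_ : ∀ {k n} → Mⁿ k n → Mⁿ k n → Mⁿ k n
(t ∧ⁿ u) i = t i ∧M u i

_∨ⁿ_ : ∀ {k n} → Mⁿ k n → Mⁿ k n → Mⁿ k n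
(t ∨ⁿ u) i = t i ∨M u i

ρ : ∀ {k n} → Mⁿ k n → ℕ
ρ {n = zero}  t = 0
ρ {n = suc n} t = ρM (t Fin.zero) + ρ (λ i → t (Fin.suc i))

-- f(t) = ρ(t)(2n − ρ(t)); truncated subtraction is exact since ρ(t) ≤ 2n.
f : ∀ {k n} → Mⁿ k n → ℕ
f {n = n} t = ρ t * (2 * n ∸ ρ t)

-- The rank ρ of Mⁿ is modular, ρ(t ∧ u) + ρ(t ∨ u) = ρ(t) + ρ(u), and for incomparable t, u the
-- meet has rank strictly below both ρ(t) and ρ(u). So the four ranks are m < a, b with
-- m + j = a + b, j ≤ 2n, and g(x) = x(2n − x) is strictly concave: writing a = m + P, b = m + Q,
-- j = m + P + Q one finds g(a) + g(b) = g(m) + g(j) + 2PQ with P, Q ≥ 1.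
module Submission where

open import Defs
open import Data.Nat using (ℕ; zero; suc; _+_; _*_; _∸_; _≤_; _<_; z≤n; s≤s)
open import Data.Nat.Properties
  using (≤-refl; ≤-trans; ≤-reflexive; +-mono-≤; +-mono-<-≤; +-mono-≤-<; m<m+n; m+n∸m≡n;
         +-suc; +-cancelˡ-≡; +-commutativeSemigroup; m≤n⇒∃[o]m+o≡n; module ≤-Reasoning)
open import Data.Nat.Tactic.RingSolver using (solve-∀)
open import Algebra.Properties.CommutativeSemigroup +-commutativeSemigroup using (interchange)
open import Data.Fin using (Fin)
open import Data.Fin.Properties using (_≟_; ¬∀⟶∃¬)
open import Data.Product using (∃; _,_)
open import Data.Empty using (⊥-elim)
open import Relation.Nullary using (¬_; Dec; yes; no)
open import Relation.Binary.PropositionalEquality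
  using (_≡_; refl; sym; trans; cong; cong₂; module ≡-Reasoning)

_≤M?_ : ∀ {k} (x y : M k) → Dec (x ≤M y)
bot    ≤M? y      = yes bot≤
x      ≤M? top    = yes ≤top
top    ≤M? bot    = no λ ()
top    ≤M? atom _ = no λ ()
atom a ≤M? bot    = no λ ()
atom a ≤M? atom b with a ≟ b
... | yes refl = yes atom≤
... | no  a≢b  = no λ { atom≤ → a≢b refl }

∧M-comm : ∀ {k} (x y : M k) → x ∧M y ≡ y ∧M x
∧M-comm bot      bot      = refl
∧M-comm bot      (atom _) = refl
∧M-comm bot      top      = refl
∧M-comm (atom _) bot      = refl
∧M-comm (atom _) top      = refl
∧M-comm top      bot      = refl
∧M-comm top      (atom _) = refl
∧M-comm top      top      = refl
∧M-comm (atom a) (atom b) with a ≟ b | b ≟ a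
... | yes refl | yes _    = refl
... | yes refl | no  a≢a  = ⊥-elim (a≢a refl)
... | no  a≢a  | yes refl = ⊥-elim (a≢a refl)
... | no  _    | no  _    = refl

ρM-modular : ∀ {k} (x y : M k) → ρM (x ∧M y) + ρM (x ∨M y) ≡ ρM x + ρM y
ρM-modular bot      y        = refl
ρM-modular top      bot      = refl
ρM-modular top      (atom _) = refl
ρM-modular top      top      = refl
ρM-modular (atom a) bot      = refl
ρM-modular (atom a) top      = refl
ρM-modular (atom a) (atom b) with a ≟ b
... | yes _ = refl
... | no  _ = refl

ρM≤2 : ∀ {k} (x : M k) → ρM x ≤ 2
ρM≤2 bot      = z≤n
ρM≤2 (atom _) = s≤s z≤n
ρM≤2 top      = ≤-refl

ρM-∧≤ˡ : ∀ {k} (x y : M k) → ρM (x ∧M y) ≤ ρM x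
ρM-∧≤ˡ bot      y        = z≤n
ρM-∧≤ˡ top      y        = ρM≤2 y
ρM-∧≤ˡ (atom a) bot      = z≤n
ρM-∧≤ˡ (atom a) top      = ≤-refl
ρM-∧≤ˡ (atom a) (atom b) with a ≟ b
... | yes _ = ≤-refl
... | no  _ = z≤n

ρM-∧<ˡ : ∀ {k} (x y : M k) → ¬ (x ≤M y) → ρM (x ∧M y) < ρM x
ρM-∧<ˡ bot      y        x≰y = ⊥-elim (x≰y bot≤)
ρM-∧<ˡ top      bot      x≰y = s≤s z≤n
ρM-∧<ˡ top      (atom _) x≰y = s≤s (s≤s z≤n)
ρM-∧<ˡ top      top      x≰y = ⊥-elim (x≰y ≤top)
ρM-∧<ˡ (atom a) bot      x≰y = s≤s z≤n
ρM-∧<ˡ (atom a) top      x≰y = ⊥-elim (x≰y ≤top)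
ρM-∧<ˡ (atom a) (atom b) x≰y with a ≟ b
... | yes refl = ⊥-elim (x≰y atom≤)
... | no  _    = s≤s z≤n

ρM-∧≤ʳ : ∀ {k} (x y : M k) → ρM (x ∧M y) ≤ ρM y
ρM-∧≤ʳ x y = ≤-trans (≤-reflexive (cong ρM (∧M-comm x y))) (ρM-∧≤ˡ y x)

ρM-∧<ʳ : ∀ {k} (x y : M k) → ¬ (y ≤M x) → ρM (x ∧M y) < ρM y
ρM-∧<ʳ x y y≰x = ≤-trans (s≤s (≤-reflexive (cong ρM (∧M-comm x y)))) (ρM-∧<ˡ y x y≰x)

module _ {k : ℕ} where

  tail : ∀ {n} → Mⁿ k (suc n) → Mⁿ k n
  tail t i = t (Fin.suc i)

  ρ-mono : ∀ {n} (t u : Mⁿ k n) → (∀ i → ρM (t i) ≤ ρM (u i)) → ρ t ≤ ρ u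
  ρ-mono {zero}  t u t≤u = z≤n
  ρ-mono {suc n} t u t≤u = +-mono-≤ (t≤u Fin.zero) (ρ-mono (tail t) (tail u) (λ i → t≤u (Fin.suc i)))

  ρ-mono-< : ∀ {n} (t u : Mⁿ k n) → (∀ i → ρM (t i) ≤ ρM (u i)) →
             ∀ i → ρM (t i) < ρM (u i) → ρ t < ρ u
  ρ-mono-< t u t≤u Fin.zero    tᵢ<uᵢ =
    +-mono-<-≤ tᵢ<uᵢ (ρ-mono (tail t) (tail u) (λ i → t≤u (Fin.suc i)))
  ρ-mono-< t u t≤u (Fin.suc i) tᵢ<uᵢ =
    +-mono-≤-< (t≤u Fin.zero) (ρ-mono-< (tail t) (tail u) (λ i → t≤u (Fin.suc i)) i tᵢ<uᵢ)

  ρ-sum-cong : ∀ {n} (t u v w : Mⁿ k n) → (∀ i → ρM (t i) + ρM (u i) ≡ ρM (v i) + ρM (w i)) →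
               ρ t + ρ u ≡ ρ v + ρ w
  ρ-sum-cong {zero}  t u v w eq = refl
  ρ-sum-cong {suc n} t u v w eq = begin
    (ρM (t Fin.zero) + ρ (tail t)) + (ρM (u Fin.zero) + ρ (tail u))
      ≡⟨ interchange (ρM (t Fin.zero)) (ρ (tail t)) (ρM (u Fin.zero)) (ρ (tail u)) ⟩
    (ρM (t Fin.zero) + ρM (u Fin.zero)) + (ρ (tail t) + ρ (tail u))
      ≡⟨ cong₂ _+_ (eq Fin.zero) (ρ-sum-cong (tail t) (tail u) (tail v) (tail w) (λ i → eq (Fin.suc i))) ⟩
    (ρM (v Fin.zero) + ρM (w Fin.zero)) + (ρ (tail v) + ρ (tail w))
      ≡⟨ interchange (ρM (v Fin.zero)) (ρM (w Fin.zero)) (ρ (tail v)) (ρ (tail w)) ⟩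
    (ρM (v Fin.zero) + ρ (tail v)) + (ρM (w Fin.zero) + ρ (tail w)) ∎
    where open ≡-Reasoning

  ρ≤2n : ∀ n (t : Mⁿ k n) → ρ t ≤ 2 * n
  ρ≤2n zero    t = z≤n
  ρ≤2n (suc n) t = ≤-trans (+-mono-≤ (ρM≤2 (t Fin.zero)) (ρ≤2n n (tail t))) (≤-reflexive (double-suc n))
    where
    double-suc : ∀ n → 2 + 2 * n ≡ 2 * suc n
    double-suc = solve-∀

  ρ-modular : ∀ {n} (t u : Mⁿ k n) → ρ (t ∧ⁿ u) + ρ (t ∨ⁿ u) ≡ ρ t + ρ u
  ρ-modular t u = ρ-sum-cong (t ∧ⁿ u) (t ∨ⁿ u) t u (λ i → ρM-modular (t i) (u i))

  ρ-∧<ˡ : ∀ {n} (t u : Mⁿ k n) → ¬ (t ≤ⁿ u) → ρ (t ∧ⁿ u) < ρ t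
  ρ-∧<ˡ t u t≰u with ¬∀⟶∃¬ _ (λ i → t i ≤M u i) (λ i → t i ≤M? u i) t≰u
  ... | i , tᵢ≰uᵢ = ρ-mono-< (t ∧ⁿ u) t (λ j → ρM-∧≤ˡ (t j) (u j)) i (ρM-∧<ˡ (t i) (u i) tᵢ≰uᵢ)

  ρ-∧<ʳ : ∀ {n} (t u : Mⁿ k n) → ¬ (u ≤ⁿ t) → ρ (t ∧ⁿ u) < ρ u
  ρ-∧<ʳ t u u≰t with ¬∀⟶∃¬ _ (λ i → u i ≤M t i) (λ i → u i ≤M? t i) u≰t
  ... | i , uᵢ≰tᵢ = ρ-mono-< (t ∧ⁿ u) u (λ j → ρM-∧≤ʳ (t j) (u j)) i (ρM-∧<ʳ (t i) (u i) uᵢ≰tᵢ)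

m+n≡o⇒o∸m≡n : ∀ m n {o} → m + n ≡ o → o ∸ m ≡ n
m+n≡o⇒o∸m≡n m n refl = m+n∸m≡n m n

concavity-gap : ∀ m P Q r → let N = m + P + Q + r in
  m * (N ∸ m) + (m + P + Q) * (N ∸ (m + P + Q)) + 2 * P * Q ≡
  (m + P) * (N ∸ (m + P)) + (m + Q) * (N ∸ (m + Q))
concavity-gap m P Q r = begin
  m * (N ∸ m) + (m + P + Q) * (N ∸ (m + P + Q)) + 2 * P * Q
    ≡⟨ cong₂ (λ α β → m * α + (m + P + Q) * β + 2 * P * Q)
             (m+n≡o⇒o∸m≡n m (P + Q + r) (split-m m P Q r)) (m+n∸m≡n (m + P + Q) r) ⟩
  m * (P + Q + r) + (m + P + Q) * r + 2 * P * Q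
    ≡⟨ expand m P Q r ⟩
  (m + P) * (Q + r) + (m + Q) * (P + r)
    ≡⟨ cong₂ (λ α β → (m + P) * α + (m + Q) * β)
             (sym (m+n≡o⇒o∸m≡n (m + P) (Q + r) (split-m+P m P Q r)))
             (sym (m+n≡o⇒o∸m≡n (m + Q) (P + r) (split-m+Q m P Q r))) ⟩
  (m + P) * (N ∸ (m + P)) + (m + Q) * (N ∸ (m + Q)) ∎
  where
  open ≡-Reasoning
  N = m + P + Q + r
  split-m : ∀ m P Q r → m + (P + Q + r) ≡ m + P + Q + r
  split-m = solve-∀
  split-m+P : ∀ m P Q r → m + P + (Q + r) ≡ m + P + Q + r
  split-m+P = solve-∀
  split-m+Q : ∀ m P Q r → m + Q + (P + r) ≡ m + P + Q + r
  split-m+Q = solve-∀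
  expand : ∀ m P Q r →
    m * (P + Q + r) + (m + P + Q) * r + 2 * P * Q ≡ (m + P) * (Q + r) + (m + Q) * (P + r)
  expand = solve-∀

<⇒∃+suc : ∀ {m n} → m < n → ∃ λ p → m + suc p ≡ n
<⇒∃+suc {m} m<n with m≤n⇒∃[o]m+o≡n m<n
... | p , m+1+p≡n = p , trans (+-suc m p) m+1+p≡n

strict-concavity : ∀ {N m a b j} → m + j ≡ a + b → m < a → m < b → j ≤ N →
  m * (N ∸ m) + j * (N ∸ j) < a * (N ∸ a) + b * (N ∸ b)
strict-concavity {N} {m} {j = j} m+j≡a+b m<a m<b j≤N
  with <⇒∃+suc m<a | <⇒∃+suc m<b
... | p , refl | q , refl
  with +-cancelˡ-≡ m j (m + suc p + suc q) (trans m+j≡a+b (regroup m (suc p) (suc q)))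
  where
  regroup : ∀ m P Q → m + P + (m + Q) ≡ m + (m + P + Q)
  regroup = solve-∀
... | refl with m≤n⇒∃[o]m+o≡n j≤N
... | r , refl = begin-strict
  m * (N ∸ m) + j * (N ∸ j)
    <⟨ m<m+n _ (s≤s z≤n) ⟩
  m * (N ∸ m) + j * (N ∸ j) + 2 * suc p * suc q
    ≡⟨ concavity-gap m (suc p) (suc q) r ⟩
  (m + suc p) * (N ∸ (m + suc p)) + (m + suc q) * (N ∸ (m + suc q)) ∎
  where open ≤-Reasoning

lemma9 : (k n : ℕ) → 3 ≤ k → 1 ≤ n → (t u : Mⁿ k n) → ¬ (t ≤ⁿ u) → ¬ (u ≤ⁿ t)
    → f (t ∧ⁿ u) + f (t ∨ⁿ u) < f t + f u
lemma9 k n _ _ t u t≰u u≰t =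
  strict-concavity (ρ-modular t u) (ρ-∧<ˡ t u t≰u) (ρ-∧<ʳ t u u≰t) (ρ≤2n n (t ∨ⁿ u))
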